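{- Let $\Gamma$ be a connected $3$-valent plane graph all of whose faces are $4$-gons or $6$-gons, and suppose $\Gamma$ is isometrically embeddable in a hypercube $H_m$. Then every $6$-gonal face of $\Gamma$ is isometric, i.e. the distance in $\Gamma$ between any two vertices of the face equals their distance along the boundary cycle of the face.
   Context: $H_m$ is the graph on $\{0,1\}^m$ with Hamming distance; isometric embeddability means there is a distance-preserving map from the vertices of $\Gamma$ (with path distance) to $\{0,1\}^m$. -}

module Defs where

open import Data.Nat using (ℕ; zero; suc; _≤_; _<_; _∸_; ∣_-_∣; _⊓_; _+_)
open import Data.Nat.Properties using (_≤?_)
open import Data.Fin using (Fin; toℕ)
open import Data.Fin.Properties using (all?)
open import Data.Bool using (Bool)
open import Data.Bool.Properties using () renaming (_≟_ to _≟ᵇ_)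
open import Data.List using (length; filter)
open import Data.List using () renaming (allFin to allFinL)
open import Data.Product using (Σ; ∃; _×_)
open import Data.Sum using (_⊎_)
open import Relation.Nullary using (¬_; ¬?)
open import Relation.Binary.PropositionalEquality using (_≡_; _≢_)

iter : {A : Set} → (A → A) → ℕ → A → A
iter f zero    x = x
iter f (suc k) x = f (iter f k x)

-- Number of orbits of a permutation f of Fin d: the number of darts that are
-- the least element (w.r.t. toℕ) of their f-orbit  { f^k x | k < d }.
orbitCount : (d : ℕ) → (Fin d → Fin d) → ℕ
orbitCount d f =
  length (filter (λ x → all? (λ (k : Fin d) → toℕ x ≤? toℕ (iter f (toℕ k) x)))
                 (allFinL d))

OrbitSize : {d : ℕ} → (Fin d → Fin d) → Fin d → ℕ → Set
OrbitSize f x k = (iter f k x ≡ x) × (∀ j → 0 < j → j < k → iter f j x ≢ x)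

hamming : {m : ℕ} → (Fin m → Bool) → (Fin m → Bool) → ℕ
hamming {m} u v = length (filter (λ i → ¬? (u i ≟ᵇ v i)) (allFinL m))

cycleDist : ℕ → ℕ → ℕ → ℕ
cycleDist L i j = ∣ i - j ∣ ⊓ (L ∸ ∣ i - j ∣)

-- A combinatorial map (rotation system) on the dart set Fin d:
-- α pairs the two darts (half-edges) of each edge, σ rotates the darts
-- around each vertex (cyclic order given by the embedding),
-- φ = σ ∘ α traces face boundaries.  Vertices / edges / faces are the
-- orbits of σ / α / φ.
record CubicMap (d : ℕ) : Set where
  field
    σ : Fin d → Fin d
    α : Fin d → Fin d
    α-invol : ∀ x → α (α x) ≡ x
    α-nofix : ∀ x → α x ≢ x
    σ-cubic : ∀ x → OrbitSize σ x 3

  φ : Fin d → Fin d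
  φ x = σ (α x)

  SameVertex : Fin d → Fin d → Set
  SameVertex x y = ∃ λ k → y ≡ iter σ k x

  Walk : ℕ → Fin d → Fin d → Set
  Walk zero    x y = SameVertex x y
  Walk (suc n) x y = ∃ λ k → Walk n (α (iter σ k x)) y

  Dist : Fin d → Fin d → ℕ → Set
  Dist x y n = Walk n x y × (∀ m → m < n → ¬ Walk m x y)

  NoLoops : Set
  NoLoops = ∀ x → ¬ SameVertex x (α x)

  NoMultiEdges : Set
  NoMultiEdges = ∀ x y → SameVertex x y → x ≢ y → ¬ SameVertex (α x) (α y)

  Connected : Set
  Connected = ∀ x y → ∃ λ n → Walk n x y

  numVertices numEdges numFaces : ℕ
  numVertices = orbitCount d σ
  numEdges    = orbitCount d α
  numFaces    = orbitCount d φ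

  -- the (connected) map lives on the sphere: Euler's formula V - E + F = 2
  Planar : Set
  Planar = numVertices + numFaces ≡ numEdges + 2

  Faces46 : Set
  Faces46 = ∀ x → OrbitSize φ x 4 ⊎ OrbitSize φ x 6

  -- isometric embedding of the vertex set into the hypercube H_m:
  -- a map on darts constant on vertices, preserving distances
  IsometricallyEmbeddable : Set
  IsometricallyEmbeddable =
    ∃ λ (m : ℕ) → Σ (Fin d → (Fin m → Bool)) λ f →
      (∀ x → f (σ x) ≡ f x) × (∀ x y n → Dist x y n → hamming (f x) (f y) ≡ n)

  IsometricHexFace : Fin d → Set
  IsometricHexFace x = ∀ (i j : Fin 6) →
    Dist (iter φ (toℕ i) x) (iter φ (toℕ j) x) (cycleDist 6 (toℕ i) (toℕ j))

{-# OPTIONS --safe #-}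
-- A hypercube is bipartite, hence so is Γ: a walk between two corners of a face has the
-- parity of their distance along the face.  Together with the absence of loops and multiple
-- edges this settles every distance on a hexagonal face, except that opposite corners might
-- be joined by a chord, the third edge at a corner.  A chord forces the faces across the six
-- edges of its face to be hexagons with chords again, so by connectivity all faces are
-- hexagons; then 3V = 2E = 6F, and V - E + F = 0 contradicts Euler's formula.
module Submission where

open import Defs
open import Data.Nat using (ℕ; zero; suc; NonZero; _+_; _*_; _∸_; _≤_; _<_; _%_; _/_; z≤n; s≤s)
open import Data.Nat.Properties
open import Data.Nat.DivMod using (_mod_; m≡m%n+[m/n]*n; m%n<n)
open import Data.Fin using (Fin; toℕ; inject≤) renaming (zero to fzero; suc to fsuc)
open import Data.Fin.Patterns using (0F; 1F; 2F; 3F; 4F; 5F)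
open import Data.Fin.Properties using (all?; toℕ-injective; toℕ<n; toℕ-fromℕ<; toℕ-inject≤; pigeonhole)
  renaming (suc-injective to fsuc-injective)
open import Data.Fin.Permutation using (Permutation′; permutation)
open import Data.Bool using (Bool; true; false; not; _xor_)
open import Data.Bool.Properties
  using (not-involutive; not-distribˡ-xor; not-distribʳ-xor; xor-same; xor-identityʳ; xor-assoc)
  renaming (_≟_ to _≟ᵇ_)
open import Data.List using (List; []; _∷_; length; filter; foldr; tabulate) renaming (allFin to allFinL)
open import Data.List.Relation.Unary.All using (lookup)
open import Data.List.Membership.Propositional.Properties using (∈-allFin)
open import Data.Product using (Σ; _×_; _,_; proj₁; proj₂)
open import Data.Sum using (_⊎_; inj₁; inj₂)
open import Data.Empty using (⊥-elim)
open import Function using (_∘_; id; case_of_)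
open import Relation.Binary using (tri<; tri≈; tri>)
open import Relation.Binary.PropositionalEquality
open import Relation.Nullary using (¬_; ¬?; Dec; yes; no)
open import Relation.Nullary.Decidable using (from-yes)
open import Relation.Unary using (Decidable)
open import Algebra.Properties.CommutativeMonoid.Sum +-0-commutativeMonoid
  using (sum; sum-syntax; sum-cong-≗; sum-permute; ∑-comm)
import Data.List.Extrema ≤-totalOrder as Extrema

iter-+ : ∀ {A : Set} (f : A → A) m n x → iter f (m + n) x ≡ iter f m (iter f n x)
iter-+ f zero    n x = refl
iter-+ f (suc m) n x = cong f (iter-+ f m n x)

iter-comm : ∀ {A : Set} (f : A → A) n x → iter f n (f x) ≡ f (iter f n x)
iter-comm f zero    x = refl
iter-comm f (suc n) x = cong f (iter-comm f n x)

iter-comm-iter : ∀ {A : Set} (f : A → A) m n x → iter f m (iter f n x) ≡ iter f n (iter f m x)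
iter-comm-iter f m n x = begin
  iter f m (iter f n x) ≡⟨ iter-+ f m n x ⟨
  iter f (m + n) x      ≡⟨ cong (λ t → iter f t x) (+-comm m n) ⟩
  iter f (n + m) x      ≡⟨ iter-+ f n m x ⟩
  iter f n (iter f m x) ∎
  where open ≡-Reasoning

iter-injective : ∀ {A : Set} {f : A → A} → (∀ {x y} → f x ≡ f y → x ≡ y) →
                 ∀ n {x y} → iter f n x ≡ iter f n y → x ≡ y
iter-injective f-inj zero    eq = eq
iter-injective f-inj (suc n) eq = iter-injective f-inj n (f-inj eq)

module _ {A : Set} (f : A → A) {K : ℕ} {x : A} (period : iter f K x ≡ x) where

  iter-periodic-* : ∀ q → iter f (q * K) x ≡ x
  iter-periodic-* zero    = refl
  iter-periodic-* (suc q) = begin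
    iter f (K + q * K) x        ≡⟨ iter-+ f K (q * K) x ⟩
    iter f K (iter f (q * K) x) ≡⟨ cong (iter f K) (iter-periodic-* q) ⟩
    iter f K x                  ≡⟨ period ⟩
    x                           ∎
    where open ≡-Reasoning

  iter-periodic-mod : .{{_ : NonZero K}} → ∀ n → iter f n x ≡ iter f (toℕ (n mod K)) x
  iter-periodic-mod n = begin
    iter f n x                            ≡⟨ cong (λ t → iter f t x) (m≡m%n+[m/n]*n n K) ⟩
    iter f (n % K + n / K * K) x          ≡⟨ iter-+ f (n % K) (n / K * K) x ⟩
    iter f (n % K) (iter f (n / K * K) x) ≡⟨ cong (iter f (n % K)) (iter-periodic-* (n / K)) ⟩
    iter f (n % K) x                      ≡⟨ cong (λ t → iter f t x) (toℕ-fromℕ< (m%n<n n K)) ⟨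
    iter f (toℕ (n mod K)) x              ∎
    where open ≡-Reasoning

orbitSize-iter : ∀ {d} {f : Fin d → Fin d} → (∀ {x y} → f x ≡ f y → x ≡ y) →
                 ∀ {x K} j → OrbitSize f x K → OrbitSize f (iter f j x) K
orbitSize-iter {f = f} f-inj {x} {K} j (period , aperiodic) =
  trans (iter-comm-iter f K j x) (cong (iter f j) period) ,
  λ i 0<i i<K eq → aperiodic i 0<i i<K (iter-injective f-inj j (trans (iter-comm-iter f j i x) eq))

indicator : ∀ {P : Set} → Dec P → ℕ
indicator (yes _) = 1
indicator (no _)  = 0

length-filter-tabulate : ∀ {d n} {P : Fin d → Set} (P? : Decidable P) (h : Fin n → Fin d) →
                         length (filter P? (tabulate h)) ≡ sum (indicator ∘ P? ∘ h)
length-filter-tabulate {n = zero}  P? h = refl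
length-filter-tabulate {n = suc n} P? h with P? (h fzero)
... | yes _ = cong suc (length-filter-tabulate P? (h ∘ fsuc))
... | no  _ = length-filter-tabulate P? (h ∘ fsuc)

sum-indicator-none : ∀ {n} {P : Fin n → Set} (P? : Decidable P) →
                     (∀ i → ¬ P i) → sum (indicator ∘ P?) ≡ 0
sum-indicator-none {zero}  P? ¬P = refl
sum-indicator-none {suc n} P? ¬P with P? fzero
... | yes p = ⊥-elim (¬P fzero p)
... | no  _ = sum-indicator-none (P? ∘ fsuc) (¬P ∘ fsuc)

sum-indicator-unique : ∀ {n} {P : Fin n → Set} (P? : Decidable P) {i} →
                       P i → (∀ j → P j → j ≡ i) → sum (indicator ∘ P?) ≡ 1
sum-indicator-unique P? {fzero} p unique with P? fzero
... | no ¬p = ⊥-elim (¬p p)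
... | yes _ = cong suc (sum-indicator-none (P? ∘ fsuc) (λ j pj → case (unique (fsuc j) pj) of λ ()))
sum-indicator-unique P? {fsuc i} p unique with P? fzero
... | yes p₀ = case unique fzero p₀ of λ ()
... | no _ = sum-indicator-unique (P? ∘ fsuc) p (λ j pj → fsuc-injective (unique (fsuc j) pj))

sum-const : ∀ n c → sum {n} (λ _ → c) ≡ n * c
sum-const zero    c = refl
sum-const (suc n) c = cong (c +_) (sum-const n c)

module UniformOrbits {d : ℕ} (f : Fin d → Fin d) (k : ℕ) (orbit : ∀ x → OrbitSize f x (suc k)) where

  private
    K : ℕ
    K = suc k

  iter-inverse : ∀ i x → iter f (k * i) (iter f i x) ≡ x
  iter-inverse i x = begin
    iter f (k * i) (iter f i x) ≡⟨ iter-+ f (k * i) i x ⟨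
    iter f (k * i + i) x        ≡⟨ cong (λ t → iter f t x) (trans (+-comm (k * i) i) (*-comm K i)) ⟩
    iter f (i * K) x            ≡⟨ iter-periodic-* f (proj₁ (orbit x)) i ⟩
    x                           ∎
    where open ≡-Reasoning

  iter-distinct : ∀ x {i j} → i < j → j < K → iter f i x ≢ iter f j x
  iter-distinct x {i} {j} i<j j<K eq = proj₂ (orbit (iter f i x)) (j ∸ i) (m<n⇒0<n∸m i<j)
    (≤-<-trans (m∸n≤m j i) j<K)
    (begin
      iter f (j ∸ i) (iter f i x) ≡⟨ iter-+ f (j ∸ i) i x ⟨
      iter f (j ∸ i + i) x        ≡⟨ cong (λ t → iter f t x) (m∸n+n≡m (<⇒≤ i<j)) ⟩
      iter f j x                  ≡⟨ eq ⟨
      iter f i x                  ∎)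
    where open ≡-Reasoning

  iter-index-injective : ∀ x {i j} → i < K → j < K → iter f i x ≡ iter f j x → i ≡ j
  iter-index-injective x {i} {j} i<K j<K eq with <-cmp i j
  ... | tri< i<j _ _ = ⊥-elim (iter-distinct x i<j j<K eq)
  ... | tri≈ _ i≡j _ = i≡j
  ... | tri> _ _ j<i = ⊥-elim (iter-distinct x j<i i<K (sym eq))

  K≤d : Fin d → K ≤ d
  K≤d x with K ≤? d
  ... | yes K≤d = K≤d
  ... | no  K≰d with pigeonhole (≰⇒> K≰d) (λ (i : Fin K) → iter f (toℕ i) x)
  ...   | i , j , i<j , eq = ⊥-elim (iter-distinct x i<j (toℕ<n j) eq)

  Least : Fin d → Set
  Least x = ∀ (j : Fin d) → toℕ x ≤ toℕ (iter f (toℕ j) x)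

  least? : Decidable Least
  least? x = all? (λ (j : Fin d) → toℕ x ≤? toℕ (iter f (toℕ j) x))

  least⇒≤iter : ∀ {y} → Least y → ∀ n → toℕ y ≤ toℕ (iter f n y)
  least⇒≤iter {y} least n = subst (λ z → toℕ y ≤ toℕ z) (sym reach) (least j)
    where
    j : Fin d
    j = inject≤ (n mod K) (K≤d y)
    reach : iter f n y ≡ iter f (toℕ j) y
    reach = trans (iter-periodic-mod f (proj₁ (orbit y)) n)
                  (cong (λ t → iter f t y) (sym (toℕ-inject≤ (n mod K) (K≤d y))))

  least-unique : ∀ x {i j} → i < K → j < K → Least (iter f i x) → Least (iter f j x) → i ≡ j
  least-unique x {i} {j} i<K j<K leastᵢ leastⱼ = iter-index-injective x i<K j<K
    (toℕ-injective (≤-antisym (below i j leastᵢ) (below j i leastⱼ)))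
    where
    below : ∀ i j → Least (iter f i x) → toℕ (iter f i x) ≤ toℕ (iter f j x)
    below i j least = subst (λ z → toℕ (iter f i x) ≤ toℕ z) reach (least⇒≤iter least (j + k * i))
      where
      reach : iter f (j + k * i) (iter f i x) ≡ iter f j x
      reach = trans (iter-+ f j (k * i) (iter f i x)) (cong (iter f j) (iter-inverse i x))

  least-exists : ∀ x → Σ (Fin K) λ j → Least (iter f (toℕ j) x)
  least-exists x = j₀ , λ i →
    subst (λ z → value j₀ ≤ toℕ z) (reach (toℕ i)) (minimal ((toℕ i + toℕ j₀) mod K))
    where
    value : Fin K → ℕ
    value j = toℕ (iter f (toℕ j) x)
    j₀ : Fin K
    j₀ = Extrema.argmin value fzero (allFinL K)
    minimal : ∀ j → value j₀ ≤ value j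
    minimal j = lookup (Extrema.f[argmin]≤f[xs] {f = value} fzero (allFinL K)) (∈-allFin j)
    reach : ∀ n → iter f (toℕ ((n + toℕ j₀) mod K)) x ≡ iter f n (iter f (toℕ j₀) x)
    reach n = trans (sym (iter-periodic-mod f (proj₁ (orbit x)) (n + toℕ j₀))) (iter-+ f n (toℕ j₀) x)

  least-count-in-orbit : ∀ x → sum (λ (j : Fin K) → indicator (least? (iter f (toℕ j) x))) ≡ 1
  least-count-in-orbit x = sum-indicator-unique (λ j → least? (iter f (toℕ j) x)) least₀
    (λ j least → toℕ-injective (least-unique x (toℕ<n j) (toℕ<n j₀) least least₀))
    where
    j₀ : Fin K
    j₀ = proj₁ (least-exists x)
    least₀ : Least (iter f (toℕ j₀) x)
    least₀ = proj₂ (least-exists x)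

  f-permutation : Permutation′ d
  f-permutation = permutation f (iter f k) (λ y → proj₁ (orbit y))
    (λ x → trans (iter-comm f k x) (proj₁ (orbit x)))

  sum-∘iter : ∀ j (h : Fin d → ℕ) → sum (h ∘ iter f j) ≡ sum h
  sum-∘iter zero    h = refl
  sum-∘iter (suc j) h = trans (sum-∘iter j (h ∘ f)) (sym (sum-permute h f-permutation))

  orbitCount*K≡d : orbitCount d f * K ≡ d
  orbitCount*K≡d = begin
    orbitCount d f * K                     ≡⟨ cong (_* K) (length-filter-tabulate least? id) ⟩
    sum rep * K                            ≡⟨ *-comm (sum rep) K ⟩
    K * sum rep                            ≡⟨ sum-const K (sum rep) ⟨
    ∑[ j < K ] sum rep                     ≡⟨ sum-cong-≗ {K} (λ j → sum-∘iter (toℕ j) rep) ⟨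
    ∑[ j < K ] ∑[ x < d ] rep (f^ j x)     ≡⟨ ∑-comm {K} {d} (λ j x → rep (f^ j x)) ⟩
    ∑[ x < d ] ∑[ j < K ] rep (f^ j x)     ≡⟨ sum-cong-≗ {d} least-count-in-orbit ⟩
    ∑[ x < d ] 1                           ≡⟨ sum-const d 1 ⟩
    d * 1                                  ≡⟨ *-identityʳ d ⟩
    d                                      ∎
    where
    open ≡-Reasoning
    rep : Fin d → ℕ
    rep = indicator ∘ least?
    f^ : Fin K → Fin d → Fin d
    f^ j = iter f (toℕ j)

isOdd : ℕ → Bool
isOdd zero    = false
isOdd (suc n) = not (isOdd n)

oddWeight : ∀ {m} → (Fin m → Bool) → List (Fin m) → Bool
oddWeight u = foldr (λ i b → u i xor b) false

isOdd-hamming : ∀ {m} (u v : Fin m → Bool) is →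
                isOdd (length (filter (λ i → ¬? (u i ≟ᵇ v i)) is)) ≡ oddWeight u is xor oddWeight v is
isOdd-hamming u v [] = refl
isOdd-hamming u v (i ∷ is) with u i | v i | isOdd-hamming u v is
... | false | false | ih = ih
... | true  | false | ih = trans (cong not ih) (not-distribˡ-xor (oddWeight u is) (oddWeight v is))
... | false | true  | ih = trans (cong not ih) (not-distribʳ-xor (oddWeight u is) (oddWeight v is))
... | true  | true  | ih = begin
  isOdd (length (filter (λ j → ¬? (u j ≟ᵇ v j)) is)) ≡⟨ ih ⟩
  a xor b                                             ≡⟨ not-involutive (a xor b) ⟨
  not (not (a xor b))                                 ≡⟨ cong not (not-distribʳ-xor a b) ⟩
  not (a xor not b)                                   ≡⟨ not-distribˡ-xor a (not b) ⟩
  not a xor not b                                     ∎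
  where
  open ≡-Reasoning
  a = oddWeight u is
  b = oddWeight v is

cycleDist-shift : ∀ (i j : Fin 6) →
                  cycleDist 6 0 (toℕ ((toℕ j + (6 ∸ toℕ i)) mod 6)) ≡ cycleDist 6 (toℕ i) (toℕ j)
cycleDist-shift = from-yes (all? {6} λ i → all? {6} λ j →
  cycleDist 6 0 (toℕ ((toℕ j + (6 ∸ toℕ i)) mod 6)) ≟ cycleDist 6 (toℕ i) (toℕ j))

module _ {d : ℕ} (Γ : CubicMap d) where
  open CubicMap Γ

  σ³ : ∀ x → σ (σ (σ x)) ≡ x
  σ³ x = proj₁ (σ-cubic x)

  σ-nofix : ∀ x → σ x ≢ x
  σ-nofix x = proj₂ (σ-cubic x) 1 (s≤s z≤n) (s≤s (s≤s z≤n))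

  σ-injective : ∀ {x y} → σ x ≡ σ y → x ≡ y
  σ-injective {x} {y} eq = trans (sym (σ³ x)) (trans (cong (σ ∘ σ) eq) (σ³ y))

  α-injective : ∀ {x y} → α x ≡ α y → x ≡ y
  α-injective {x} {y} eq = trans (sym (α-invol x)) (trans (cong α eq) (α-invol y))

  φ-injective : ∀ {x y} → φ x ≡ φ y → x ≡ y
  φ-injective = α-injective ∘ σ-injective

  σ²∘φ : ∀ x → σ (σ (φ x)) ≡ α x
  σ²∘φ x = σ³ (α x)

  σ≡φ∘α : ∀ x → σ x ≡ φ (α x)
  σ≡φ∘α x = cong σ (sym (α-invol x))

  sameVertex-refl : ∀ x → SameVertex x x
  sameVertex-refl x = 0 , refl

  sameVertex-σ : ∀ x → SameVertex x (σ x)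
  sameVertex-σ x = 1 , refl

  sameVertex-cases : ∀ {x y} → SameVertex x y → y ≡ x ⊎ y ≡ σ x ⊎ y ≡ σ (σ x)
  sameVertex-cases (zero , refl) = inj₁ refl
  sameVertex-cases (suc zero , refl) = inj₂ (inj₁ refl)
  sameVertex-cases (suc (suc zero) , refl) = inj₂ (inj₂ refl)
  sameVertex-cases {x} (suc (suc (suc k)) , refl) with sameVertex-cases (k , refl)
  ... | inj₁ eq        = inj₁ (trans (σ³ _) eq)
  ... | inj₂ (inj₁ eq) = inj₂ (inj₁ (trans (σ³ _) eq))
  ... | inj₂ (inj₂ eq) = inj₂ (inj₂ (trans (σ³ _) eq))

  sameVertex-sym : ∀ {x y} → SameVertex x y → SameVertex y x
  sameVertex-sym {x} xy with sameVertex-cases xy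
  ... | inj₁ refl        = 0 , refl
  ... | inj₂ (inj₁ refl) = 2 , sym (σ³ x)
  ... | inj₂ (inj₂ refl) = 1 , sym (σ³ x)

  sameVertex-trans : ∀ {x y z} → SameVertex x y → SameVertex y z → SameVertex x z
  sameVertex-trans {x} (k , refl) (l , refl) = l + k , sym (iter-+ σ l k x)

  neighbour-cases : ∀ {y z} → Walk 1 y z →
                    SameVertex (α y) z ⊎ SameVertex (α (σ y)) z ⊎ SameVertex (α (σ (σ y))) z
  neighbour-cases {y} {z} (k , end) with sameVertex-cases {y} (k , refl)
  ... | inj₁ start        = inj₁ (subst (λ v → SameVertex (α v) z) start end)
  ... | inj₂ (inj₁ start) = inj₂ (inj₁ (subst (λ v → SameVertex (α v) z) start end))
  ... | inj₂ (inj₂ start) = inj₂ (inj₂ (subst (λ v → SameVertex (α v) z) start end))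

  walk-face : ∀ t y → Walk t y (iter φ t y)
  walk-face zero    y = sameVertex-refl y
  walk-face (suc t) y = 0 , walk-from-α t y
    where
    walk-from-α : ∀ t y → Walk t (α y) (iter φ (suc t) y)
    walk-from-α zero    y = sameVertex-σ (α y)
    walk-from-α (suc t) y = 1 , subst (Walk t (α (φ y))) (iter-comm φ (suc t) y) (walk-from-α t (φ y))

  α∘σ²∘φ : ∀ w → α (σ (σ (φ w))) ≡ w
  α∘σ²∘φ w = trans (cong α (σ²∘φ w)) (α-invol w)

  walk-face⁻¹ : ∀ w → Walk 1 (φ w) w
  walk-face⁻¹ w = 2 , (0 , sym (α∘σ²∘φ w))

  walk-face⁻² : ∀ w → Walk 2 (φ (φ w)) w
  walk-face⁻² w = 2 , subst (λ y → Walk 1 y w) (sym (α∘σ²∘φ (φ w))) (walk-face⁻¹ w)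

  record Bipartition : Set where
    field
      colour   : Fin d → Bool
      colour-σ : ∀ x → colour (σ x) ≡ colour x
      colour-α : ∀ x → colour (α x) ≡ not (colour x)

    colour-iter-σ : ∀ k x → colour (iter σ k x) ≡ colour x
    colour-iter-σ zero    x = refl
    colour-iter-σ (suc k) x = trans (colour-σ (iter σ k x)) (colour-iter-σ k x)

    walk-parity : ∀ n {x y} → Walk n x y → isOdd n ≡ colour x xor colour y
    walk-parity zero {x} (k , refl) =
      trans (sym (xor-same (colour x))) (cong (colour x xor_) (sym (colour-iter-σ k x)))
    walk-parity (suc n) {x} {y} (k , w) = begin
      not (isOdd n)                              ≡⟨ cong not (walk-parity n w) ⟩
      not (colour (α (iter σ k x)) xor colour y) ≡⟨ cong (λ c → not (c xor colour y)) colour-α-start ⟩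
      not (not (colour x) xor colour y)          ≡⟨ not-distribˡ-xor (not (colour x)) (colour y) ⟩
      not (not (colour x)) xor colour y          ≡⟨ cong (_xor colour y) (not-involutive (colour x)) ⟩
      colour x xor colour y                      ∎
      where
      open ≡-Reasoning
      colour-α-start : colour (α (iter σ k x)) ≡ not (colour x)
      colour-α-start = trans (colour-α (iter σ k x)) (cong not (colour-iter-σ k x))

    colour-iter-φ : ∀ t x → colour (iter φ t x) ≡ colour x xor isOdd t
    colour-iter-φ zero    x = sym (xor-identityʳ (colour x))
    colour-iter-φ (suc t) x = begin
      colour (σ (α (iter φ t x)))          ≡⟨ trans (colour-σ _) (colour-α _) ⟩
      not (colour (iter φ t x))            ≡⟨ cong not (colour-iter-φ t x) ⟩
      not (colour x xor isOdd t)           ≡⟨ not-distribʳ-xor (colour x) (isOdd t) ⟩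
      colour x xor not (isOdd t)           ∎
      where open ≡-Reasoning

    face-walk-parity : ∀ n t {x} → Walk n x (iter φ t x) → isOdd n ≡ isOdd t
    face-walk-parity n t {x} w = begin
      isOdd n                              ≡⟨ walk-parity n w ⟩
      colour x xor colour (iter φ t x)     ≡⟨ cong (colour x xor_) (colour-iter-φ t x) ⟩
      colour x xor (colour x xor isOdd t)  ≡⟨ xor-assoc (colour x) (colour x) (isOdd t) ⟨
      (colour x xor colour x) xor isOdd t  ≡⟨ cong (_xor isOdd t) (xor-same (colour x)) ⟩
      isOdd t                              ∎
      where open ≡-Reasoning

  embeddable⇒bipartition : NoLoops → IsometricallyEmbeddable → Bipartition
  embeddable⇒bipartition noLoops (m , F , F-σ , F-isometric) = record
    { colour   = colour
    ; colour-σ = λ x → cong (λ u → oddWeight u (allFinL m)) (F-σ x)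
    ; colour-α = λ x → flip-colour (trans (cong isOdd (sym (F-isometric x (α x) 1 (adjacent x))))
                                          (isOdd-hamming (F x) (F (α x)) (allFinL m)))
    }
    where
    colour : Fin d → Bool
    colour x = oddWeight (F x) (allFinL m)
    adjacent : ∀ x → Dist x (α x) 1
    adjacent x = (0 , sameVertex-refl (α x)) , λ { zero _ → noLoops x ; (suc _) (s≤s ()) }
    flip-colour : ∀ {a b} → true ≡ a xor b → b ≡ not a
    flip-colour {true}  {false} _ = refl
    flip-colour {false} {true}  _ = refl

  walk-invariant : {P : Fin d → Set} → (∀ {x} → P x → P (σ x)) → (∀ {x} → P x → P (α x)) →
                   ∀ n {x y} → Walk n x y → P x → P y
  walk-invariant {P} P-σ P-α = go
    where
    P-iter-σ : ∀ k {x} → P x → P (iter σ k x)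
    P-iter-σ zero    p = p
    P-iter-σ (suc k) p = P-σ (P-iter-σ k p)
    go : ∀ n {x y} → Walk n x y → P x → P y
    go zero    (k , refl) p = P-iter-σ k p
    go (suc n) (k , w)    p = go n w (P-α (P-iter-σ k p))

  all-hexagons⇒¬planar : (∀ y → OrbitSize φ y 6) → ¬ Planar
  all-hexagons⇒¬planar hex planar = case +-cancelˡ-≡ (d * 3) 0 12 d*3≡d*3+12 of λ ()
    where
    V E F : ℕ
    V = numVertices
    E = numEdges
    F = numFaces
    α-orbits : ∀ x → OrbitSize α x 2
    α-orbits x = α-invol x , λ { (suc zero) _ _ → α-nofix x ; (suc (suc _)) _ (s≤s (s≤s ())) }
    V*3≡d : V * 3 ≡ d
    V*3≡d = UniformOrbits.orbitCount*K≡d σ 2 σ-cubic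
    E*2≡d : E * 2 ≡ d
    E*2≡d = UniformOrbits.orbitCount*K≡d α 1 α-orbits
    F*6≡d : F * 6 ≡ d
    F*6≡d = UniformOrbits.orbitCount*K≡d φ 5 hex
    open ≡-Reasoning
    d*3≡d*3+12 : d * 3 + 0 ≡ d * 3 + 12
    d*3≡d*3+12 = begin
      d * 3 + 0                ≡⟨ +-identityʳ (d * 3) ⟩
      d * 3                    ≡⟨ *-distribˡ-+ d 2 1 ⟩
      d * 2 + d * 1            ≡⟨ cong (d * 2 +_) (*-identityʳ d) ⟩
      d * 2 + d                ≡⟨ cong₂ (λ a b → a * 2 + b) V*3≡d F*6≡d ⟨
      V * 3 * 2 + F * 6        ≡⟨ cong (_+ F * 6) (*-assoc V 3 2) ⟩
      V * 6 + F * 6            ≡⟨ *-distribʳ-+ 6 V F ⟨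
      (V + F) * 6              ≡⟨ cong (_* 6) planar ⟩
      (E + 2) * 6              ≡⟨ *-distribʳ-+ 6 E 2 ⟩
      E * 6 + 12               ≡⟨ cong (_+ 12) (*-assoc E 2 3) ⟨
      E * 2 * 3 + 12           ≡⟨ cong (λ a → a * 3 + 12) E*2≡d ⟩
      d * 3 + 12               ∎

  ¬sameVertex-φ : NoLoops → ∀ y → ¬ SameVertex y (φ y)
  ¬sameVertex-φ noLoops y yy₁ = noLoops y (sameVertex-trans yy₁ (sameVertex-sym (sameVertex-σ (α y))))

  sameVertex-σ²-σ : ∀ x → SameVertex (σ (σ x)) (σ x)
  sameVertex-σ²-σ x = 2 , cong σ (sym (σ³ x))

  hexagon-φ⁵ : ∀ {y} → OrbitSize φ y 6 → iter φ 5 y ≡ α (σ (σ y))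
  hexagon-φ⁵ {y} (period , _) = trans (sym (α∘σ²∘φ (iter φ 5 y))) (cong (α ∘ σ ∘ σ) period)

  -- σ y is the edge at the vertex of y that is not on the face of y, so a chord joins
  -- opposite corners of that face.
  Chord : Fin d → Set
  Chord y = SameVertex (α (σ y)) (iter φ 3 y)

  module _ (noMulti : NoMultiEdges) where

    no-double-edge : ∀ x → ¬ SameVertex (α x) (α (σ x))
    no-double-edge x = noMulti x (σ x) (sameVertex-σ x) (σ-nofix x ∘ sym)

    ¬sameVertex-φ² : ∀ y → ¬ SameVertex y (φ (φ y))
    ¬sameVertex-φ² y yy₂ = no-double-edge (α y)
      (subst (λ v → SameVertex v (α (σ (α y)))) (sym (α-invol y))
        (sameVertex-trans yy₂ (sameVertex-sym (sameVertex-σ (α (φ y))))))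

    module _ (faces46 : Faces46) where

      chord⇒hexagon : ∀ {y} → Chord y → OrbitSize φ y 6
      chord⇒hexagon {y} chord with faces46 y
      ... | inj₂ hexagon     = hexagon
      ... | inj₁ (square , _) =
        ⊥-elim (no-double-edge (σ y) (subst (SameVertex (α (σ y))) (sym ασ²y≡y₃) chord))
        where
        ασ²y≡y₃ : α (σ (σ y)) ≡ iter φ 3 y
        ασ²y≡y₃ = trans (cong (α ∘ σ ∘ σ) (sym square)) (α∘σ²∘φ (iter φ 3 y))

      chord-end : ∀ {z} → Chord z → α (σ z) ≡ σ (iter φ 3 z)
      chord-end {z} chord with sameVertex-cases (sameVertex-sym chord)
      ... | inj₂ (inj₁ end) = end
      ... | inj₁ end =
        ⊥-elim (¬sameVertex-φ² z₄ (subst (SameVertex z₄) (sym (proj₁ (chord⇒hexagon chord))) z₄~z))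
        where
        z₄ = iter φ 4 z
        σz≡αz₃ : σ z ≡ α (iter φ 3 z)
        σz≡αz₃ = trans (sym (α-invol (σ z))) (cong α end)
        z₄~z : SameVertex z₄ z
        z₄~z = 1 , trans (sym (σ³ z)) (cong (σ ∘ σ) σz≡αz₃)
      ... | inj₂ (inj₂ end) =
        ⊥-elim (¬sameVertex-φ² z (subst (SameVertex z) σz≡z₂ (sameVertex-σ z)))
        where
        σz≡z₂ : σ z ≡ iter φ 2 z
        σz≡z₂ = α-injective (trans end (σ²∘φ (iter φ 2 z)))

      φ²∘α : ∀ {z} → Chord z → iter φ 2 (α z) ≡ α (iter φ 2 z)
      φ²∘α {z} chord = begin
        σ (α (σ (α (α z))))    ≡⟨ cong (σ ∘ α ∘ σ) (α-invol z) ⟩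
        σ (α (σ z))            ≡⟨ cong σ (chord-end chord) ⟩
        σ (σ (iter φ 3 z))     ≡⟨ σ²∘φ (iter φ 2 z) ⟩
        α (iter φ 2 z)         ∎
        where open ≡-Reasoning

      φ³∘α : ∀ {z} → Chord z → iter φ 3 (α z) ≡ σ (iter φ 2 z)
      φ³∘α {z} chord = trans (cong (σ ∘ α) (φ²∘α chord)) (cong σ (α-invol (iter φ 2 z)))

      chord-α : ∀ {z} → Chord z → Chord (α z)
      chord-α {z} chord =
        subst₂ SameVertex (σ²∘φ (φ z)) (sym (φ³∘α chord)) (sameVertex-σ²-σ (iter φ 2 z))

      chord-opposite : ∀ {z} → Chord z → Chord (iter φ 3 z)
      chord-opposite {z} chord =
        subst₂ SameVertex σz≡ασz₃ (sym (proj₁ (chord⇒hexagon chord))) (2 , sym (σ³ z))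
        where
        σz≡ασz₃ : σ z ≡ α (σ (iter φ 3 z))
        σz≡ασz₃ = trans (sym (α-invol (σ z))) (cong α (chord-end chord))

      across : Fin d → Fin d
      across z = α (σ (iter φ 2 z))

      φ∘across : ∀ z → φ (across z) ≡ α (φ z)
      φ∘across z = trans (cong σ (α-invol (σ (iter φ 2 z)))) (σ²∘φ (φ z))

      chord-across : ∀ {z} → Chord z → Chord (across z)
      chord-across {z} chord = subst₂ SameVertex (sym ασw≡σ²t) (sym φ³w≡σt) (sameVertex-σ²-σ t)
        where
        a = α z
        hexagon-a = chord⇒hexagon (chord-α chord)
        t = α (σ (iter φ 1 z))
        ασw≡σ²t : α (σ (across z)) ≡ σ (σ t)
        ασw≡σ²t = begin
          α (σ (across z))            ≡⟨ cong (α ∘ φ) (φ³∘α chord) ⟨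
          α (iter φ 4 a)              ≡⟨ σ²∘φ (iter φ 4 a) ⟨
          σ (σ (iter φ 5 a))          ≡⟨ cong (σ ∘ σ) (hexagon-φ⁵ hexagon-a) ⟩
          σ (σ t)                     ∎
          where open ≡-Reasoning
        φ³w≡σt : iter φ 3 (across z) ≡ σ t
        φ³w≡σt = trans (cong (φ ∘ φ) (φ∘across z)) (cong (φ ∘ σ) (α-invol (φ z)))

      OnChordFace : Fin d → Set
      OnChordFace y = Σ (Fin d) λ z → Σ ℕ λ j → y ≡ iter φ j z × Chord z

      onChordFace-φ : ∀ {y} → OnChordFace y → OnChordFace (φ y)
      onChordFace-φ (z , j , refl , chord) = z , suc j , refl , chord

      -- α (iter φ j z) lies on the face across the j-th edge of the face of z.
      onChordFace-α-iter : ∀ j {z} → Chord z → OnChordFace (α (iter φ j z))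
      onChordFace-α-iter 0 {z} chord = α z , 0 , refl , chord-α chord
      onChordFace-α-iter 1 {z} chord = across z , 1 , sym (φ∘across z) , chord-across chord
      onChordFace-α-iter 2 {z} chord = α z , 2 , sym (φ²∘α chord) , chord-α chord
      onChordFace-α-iter 3 chord = onChordFace-α-iter 0 (chord-opposite chord)
      onChordFace-α-iter 4 chord = onChordFace-α-iter 1 (chord-opposite chord)
      onChordFace-α-iter 5 chord = onChordFace-α-iter 2 (chord-opposite chord)
      onChordFace-α-iter (suc (suc (suc (suc (suc (suc j)))))) {z} chord =
        subst (OnChordFace ∘ α) (sym (proj₁ (orbitSize-iter φ-injective j (chord⇒hexagon chord))))
          (onChordFace-α-iter j chord)

      onChordFace-α : ∀ {y} → OnChordFace y → OnChordFace (α y)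
      onChordFace-α (z , j , refl , chord) = onChordFace-α-iter j chord

      onChordFace-σ : ∀ {y} → OnChordFace y → OnChordFace (σ y)
      onChordFace-σ {y} on = subst OnChordFace (sym (σ≡φ∘α y)) (onChordFace-φ (onChordFace-α on))

      ¬chord : Connected → Planar → ∀ z → ¬ Chord z
      ¬chord connected planar z chord = all-hexagons⇒¬planar hexagon planar
        where
        hexagon : ∀ y → OrbitSize φ y 6
        hexagon y with walk-invariant {OnChordFace} onChordFace-σ onChordFace-α _
                         (proj₂ (connected z y)) (z , 0 , refl , chord)
        ... | z′ , j , refl , chord′ = orbitSize-iter φ-injective j (chord⇒hexagon chord′)

  module _ (noLoops : NoLoops) (noMulti : NoMultiEdges) (B : Bipartition) (chordless : ∀ z → ¬ Chord z) where
    open Bipartition B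

    -- The neighbours of corner 0 are corner 1, corner 5 and the far end of its third edge.
    ¬walk₁-opposite : ∀ {y} → OrbitSize φ y 6 → ¬ Walk 1 y (iter φ 3 y)
    ¬walk₁-opposite {y} hexagon w with neighbour-cases w
    ... | inj₁ αy~y₃ =
      ¬sameVertex-φ² noMulti (φ y) (sameVertex-trans (sameVertex-sym (sameVertex-σ (α y))) αy~y₃)
    ... | inj₂ (inj₁ chord) = chordless y chord
    ... | inj₂ (inj₂ ασ²y~y₃) =
      ¬sameVertex-φ² noMulti (iter φ 3 y)
        (sameVertex-sym (subst (λ v → SameVertex v (iter φ 3 y)) (sym (hexagon-φ⁵ hexagon)) ασ²y~y₃))

    parity-mismatch : ∀ n t {y} → isOdd n ≢ isOdd t → ¬ Walk n y (iter φ t y)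
    parity-mismatch n t odd≢ w = odd≢ (face-walk-parity n t w)

    dist-face : ∀ {y} → OrbitSize φ y 6 →
                (t : Fin 6) → Dist y (iter φ (toℕ t) y) (cycleDist 6 0 (toℕ t))
    dist-face {y} hexagon 0F = sameVertex-refl y , λ _ ()
    dist-face {y} hexagon 1F = walk-face 1 y , λ
      { 0 _ → ¬sameVertex-φ noLoops y
      ; (suc _) (s≤s ()) }
    dist-face {y} hexagon 2F = walk-face 2 y , λ
      { 0 _ → ¬sameVertex-φ² noMulti y
      ; 1 _ → parity-mismatch 1 2 (λ ())
      ; (suc (suc _)) (s≤s (s≤s ())) }
    dist-face {y} hexagon 3F = walk-face 3 y , λ
      { 0 _ → parity-mismatch 0 3 (λ ())
      ; 1 _ → ¬walk₁-opposite hexagon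
      ; 2 _ → parity-mismatch 2 3 (λ ())
      ; (suc (suc (suc _))) (s≤s (s≤s (s≤s ()))) }
    dist-face {y} (period , _) 4F = subst (λ v → Walk 2 v (iter φ 4 y)) period (walk-face⁻² (iter φ 4 y)) , λ
      { 0 _ w → ¬sameVertex-φ² noMulti (iter φ 4 y)
                  (subst (SameVertex (iter φ 4 y)) (sym period) (sameVertex-sym w))
      ; 1 _ → parity-mismatch 1 4 (λ ())
      ; (suc (suc _)) (s≤s (s≤s ())) }
    dist-face {y} (period , _) 5F = subst (λ v → Walk 1 v (iter φ 5 y)) period (walk-face⁻¹ (iter φ 5 y)) , λ
      { 0 _ w → ¬sameVertex-φ noLoops (iter φ 5 y)
                  (subst (SameVertex (iter φ 5 y)) (sym period) (sameVertex-sym w))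
      ; (suc _) (s≤s ()) }

    isometric-hexagon : ∀ {x} → OrbitSize φ x 6 → IsometricHexFace x
    isometric-hexagon {x} hexagon i j =
      subst₂ (Dist y) reach (cycleDist-shift i j) (dist-face hexagon-y (n mod 6))
      where
      y = iter φ (toℕ i) x
      n = toℕ j + (6 ∸ toℕ i)
      hexagon-y = orbitSize-iter φ-injective (toℕ i) hexagon
      i≤6 : toℕ i ≤ 6
      i≤6 = <⇒≤ (toℕ<n i)
      reach : iter φ (toℕ (n mod 6)) y ≡ iter φ (toℕ j) x
      reach = begin
        iter φ (toℕ (n mod 6)) y                ≡⟨ iter-periodic-mod φ (proj₁ hexagon-y) n ⟨
        iter φ n y                              ≡⟨ iter-+ φ n (toℕ i) x ⟨
        iter φ (toℕ j + (6 ∸ toℕ i) + toℕ i) x  ≡⟨ cong (λ t → iter φ t x) (+-assoc (toℕ j) _ _) ⟩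
        iter φ (toℕ j + (6 ∸ toℕ i + toℕ i)) x  ≡⟨ cong (λ t → iter φ (toℕ j + t) x) (m∸n+n≡m i≤6) ⟩
        iter φ (toℕ j + 6) x                    ≡⟨ iter-+ φ (toℕ j) 6 x ⟩
        iter φ (toℕ j) (iter φ 6 x)             ≡⟨ cong (iter φ (toℕ j)) (proj₁ hexagon) ⟩
        iter φ (toℕ j) x                        ∎
        where open ≡-Reasoning

lemma6 : ∀ (d : ℕ) (Γ : CubicMap d) → CubicMap.NoLoops Γ → CubicMap.NoMultiEdges Γ → CubicMap.Connected Γ → CubicMap.Planar Γ → CubicMap.Faces46 Γ → CubicMap.IsometricallyEmbeddable Γ → ∀ (x : Fin d) → OrbitSize (CubicMap.φ Γ) x 6 → CubicMap.IsometricHexFace Γ x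
lemma6 d Γ noLoops noMulti connected planar faces46 embeddable x =
  isometric-hexagon Γ noLoops noMulti (embeddable⇒bipartition Γ noLoops embeddable)
    (¬chord Γ noMulti faces46 connected planar)
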